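{- Let $t$ be an LSC term such that $t\!\downarrow$ is a $\beta$-normal form. Then $t$ is a useful normal form (i.e. $t$ has no useful redex).
   Context: LSC terms: $t::= x\mid \lambda x.t\mid tu\mid t[x\leftarrow u]$ (explicit substitution binding $x$), modulo $\alpha$. Shallow contexts $C::=\langle\cdot\rangle\mid \lambda x.C\mid Ct\mid tC\mid C[x\leftarrow t]$; substitution contexts $L::=\langle\cdot\rangle\mid L[x\leftarrow t]$; applicative contexts $A::=C\langle L\,t\rangle$. Redexes (in shallow contexts): ${\tt dB}$: $(L\langle\lambda x.t\rangle)u\to L\langle t[x\leftarrow u]\rangle$; ${\tt ls}$: $C\langle x\rangle[x\leftarrow u]\to C\langle u\rangle[x\leftarrow u]$ ($C$ not capturing $x$); an ${\tt ls}$-step $D\langle C\langle x\rangle[x\leftarrow u]\rangle\to D\langle C\langle u\rangle[x\leftarrow u]\rangle$ is written compactly $E\langle x\rangle\to E\langle u\rangle$ with $E=D\langle C[x\leftarrow u]\rangle$. Unfolding: $x\!\downarrow=x$, $(tu)\!\downarrow=t\!\downarrow u\!\downarrow$, $(\lambda x.t)\!\downarrow=\lambda x.t\!\downarrow$, $(t[x\leftarrow u])\!\downarrow=t\!\downarrow\{x\leftarrow u\!\downarrow\}$; relative unfolding $t\!\downarrow_{\langle\cdot\rangle}=t\!\downarrow$, $t\!\downarrow_{uC}=t\!\downarrow_{Cu}=t\!\downarrow_{\lambda x.C}=t\!\downarrow_C$, $t\!\downarrow_{C[x\leftarrow u]}=t\!\downarrow_C\{x\leftarrow u\!\downarrow\}$.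 A redex is useful if it is a ${\tt dB}$-redex, or an ${\tt ls}$-redex $C\langle x\rangle\to C\langle r\rangle$ (compact form) such that $r\!\downarrow_C$ contains a $\beta$-redex, or $r\!\downarrow_C$ is an abstraction and $C$ is applicative. -}

module Defs where

open import Data.Nat using (ℕ; zero; suc; _+_)
open import Data.Product using (Σ; ∃; _×_; _,_)
open import Data.Sum using (_⊎_)
open import Relation.Binary.PropositionalEquality using (_≡_)

-- LSC terms, de Bruijn indices (α-equivalence is syntactic identity).
-- `es t u` is  t[x←u]  : the variable x is index 0 in t, u is outside its scope.
data Term : Set where
  var : ℕ → Term
  lam : Term → Term
  app : Term → Term → Term
  es  : Term → Term → Term

ext : (ℕ → ℕ) → ℕ → ℕ
ext ρ zero    = zero
ext ρ (suc i) = suc (ρ i)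

rename : (ℕ → ℕ) → Term → Term
rename ρ (var i)   = var (ρ i)
rename ρ (lam t)   = lam (rename (ext ρ) t)
rename ρ (app t u) = app (rename ρ t) (rename ρ u)
rename ρ (es t u)  = es (rename (ext ρ) t) (rename ρ u)

shift : ℕ → Term → Term
shift k = rename (k +_)

exts : (ℕ → Term) → ℕ → Term
exts σ zero    = var zero
exts σ (suc i) = rename suc (σ i)

extsN : ℕ → (ℕ → Term) → ℕ → Term
extsN zero    σ = σ
extsN (suc k) σ = exts (extsN k σ)

subst : (ℕ → Term) → Term → Term
subst σ (var i)   = σ i
subst σ (lam t)   = lam (subst (exts σ) t)
subst σ (app t u) = app (subst σ t) (subst σ u)
subst σ (es t u)  = es (subst (exts σ) t) (subst σ u)

single : Term → ℕ → Term
single u zero    = u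
single u (suc i) = var i

unfold : Term → Term
unfold (var i)   = var i
unfold (lam t)   = lam (unfold t)
unfold (app t u) = app (unfold t) (unfold u)
unfold (es t u)  = subst (single (unfold u)) (unfold t)

data Ctx : Set where
  hole : Ctx
  cλ   : Ctx → Ctx
  cappL : Ctx → Term → Ctx
  cappR : Term → Ctx → Ctx
  ces  : Ctx → Term → Ctx

plug : Ctx → Term → Term
plug hole t        = t
plug (cλ C) t      = lam (plug C t)
plug (cappL C u) t = app (plug C t) u
plug (cappR u C) t = app u (plug C t)
plug (ces C u) t   = es (plug C t) u

_∘C_ : Ctx → Ctx → Ctx
hole      ∘C C = C
cλ D      ∘C C = cλ (D ∘C C)
cappL D u ∘C C = cappL (D ∘C C) u
cappR u D ∘C C = cappR u (D ∘C C)
ces D u   ∘C C = ces (D ∘C C) u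

depth : Ctx → ℕ
depth hole        = zero
depth (cλ C)      = suc (depth C)
depth (cappL C _) = depth C
depth (cappR _ C) = depth C
depth (ces C _)   = suc (depth C)

-- number of λ-binders of C above its hole (the ES-bound ones disappear by unfolding)
lams : Ctx → ℕ
lams hole        = zero
lams (cλ C)      = suc (lams C)
lams (cappL C _) = lams C
lams (cappR _ C) = lams C
lams (ces C _)   = lams C

data SCtx : Set where
  shole : SCtx
  sces  : SCtx → Term → SCtx

toCtx : SCtx → Ctx
toCtx shole      = hole
toCtx (sces L u) = ces (toCtx L) u

-- relative unfolding  t↓_C
--   t↓_⟨·⟩ = t↓ ; t↓_{uC} = t↓_{Cu} = t↓_{λx.C} = t↓_C ; t↓_{C[x←u]} = t↓_C{x←u↓}
relUnfold : Ctx → Term → Term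
relUnfold hole t        = unfold t
relUnfold (cλ C) t      = relUnfold C t
relUnfold (cappL C _) t = relUnfold C t
relUnfold (cappR _ C) t = relUnfold C t
relUnfold (ces C u) t   = subst (extsN (lams C) (single (unfold u))) (relUnfold C t)

data HasβRedex : Term → Set where
  here  : ∀ t u → HasβRedex (app (lam t) u)
  inλ   : ∀ {t} → HasβRedex t → HasβRedex (lam t)
  appl  : ∀ {t u} → HasβRedex t → HasβRedex (app t u)
  appr  : ∀ {t u} → HasβRedex u → HasβRedex (app t u)
  esl   : ∀ {t u} → HasβRedex t → HasβRedex (es t u)
  esr   : ∀ {t u} → HasβRedex u → HasβRedex (es t u)

βNormal : Term → Set
βNormal t = HasβRedex t → Data.Empty.⊥
  where import Data.Empty

data IsAbs : Term → Set where
  isAbs : ∀ t → IsAbs (lam t)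

Applicative : Ctx → Set
Applicative E = Σ Ctx λ C → Σ SCtx λ L → Σ Term λ t → E ≡ C ∘C cappL (toCtx L) t

DBRedex : Term → Set
DBRedex t = Σ Ctx λ C → Σ SCtx λ L → Σ Term λ s → Σ Term λ u →
  t ≡ plug C (app (plug (toCtx L) (lam s)) u)

-- a useful ls-redex:  t = D⟨C⟨x⟩[x←u]⟩ with C not capturing x (x is index depth C
-- at the hole), written compactly E⟨x⟩ → E⟨u⟩ with E = D⟨C[x←u]⟩; the substituted
-- term r (= u, weakened to the scope of the hole) is such that r↓_E contains a
-- β-redex, or r↓_E is an abstraction and E is applicative.
UsefulLSRedex : Term → Set
UsefulLSRedex t = Σ Ctx λ D → Σ Ctx λ C → Σ Term λ u →
  (t ≡ plug D (es (plug C (var (depth C))) u)) ×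
  (let E = D ∘C ces C u
       r = relUnfold E (shift (suc (depth C)) u)
   in HasβRedex r ⊎ (IsAbs r × Applicative E))

UsefulRedex : Term → Set
UsefulRedex t = DBRedex t ⊎ UsefulLSRedex t

UsefulNormal : Term → Set
UsefulNormal t = UsefulRedex t → Data.Empty.⊥
  where import Data.Empty

-- The unfolding of a term relative to a shallow context C is exactly what the content
-- of the hole becomes inside the full unfolding: t↓_C occurs in C⟨t⟩↓ beneath the
-- λ-binders of C.  Hence every useful redex exhibits a β-redex of the unfolding.  For
-- a dB-redex, or an applicative context whose hole unfolds to an abstraction, the
-- abstraction ends up applied in the unfolding (substitution contexts only apply
-- substitutions, which preserve abstractions).  For an ls-redex C⟨x⟩[x←u], the
-- variable x and the term u have the same unfolding relative to C[x←u], so the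
-- usefulness condition on u speaks about the unfolding of x, a subterm of t↓.
module Submission where

open import Defs
open import Data.Nat using (ℕ; zero; suc; _+_)
open import Data.Nat.Properties using (+-suc; +-identityʳ)
open import Data.Product using (_×_; _,_)
open import Data.Sum using (_⊎_; inj₁; inj₂)
open import Function using (_∘_)
open import Relation.Binary.PropositionalEquality
  using (_≡_; refl; sym; trans; cong; cong₂; module ≡-Reasoning)
  renaming (subst to transport)

open ≡-Reasoning

ext-cong : ∀ {ρ ρ′ : ℕ → ℕ} → (∀ i → ρ i ≡ ρ′ i) → ∀ i → ext ρ i ≡ ext ρ′ i
ext-cong eq zero    = refl
ext-cong eq (suc i) = cong suc (eq i)

rename-cong : ∀ {ρ ρ′ : ℕ → ℕ} → (∀ i → ρ i ≡ ρ′ i) → ∀ t → rename ρ t ≡ rename ρ′ t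
rename-cong eq (var i)   = cong var (eq i)
rename-cong eq (lam t)   = cong lam (rename-cong (ext-cong eq) t)
rename-cong eq (app t u) = cong₂ app (rename-cong eq t) (rename-cong eq u)
rename-cong eq (es t u)  = cong₂ es (rename-cong (ext-cong eq) t) (rename-cong eq u)

ext-id : ∀ i → ext (λ j → j) i ≡ i
ext-id zero    = refl
ext-id (suc i) = refl

rename-id : ∀ t → rename (λ i → i) t ≡ t
rename-id (var i)   = refl
rename-id (lam t)   = cong lam (trans (rename-cong ext-id t) (rename-id t))
rename-id (app t u) = cong₂ app (rename-id t) (rename-id u)
rename-id (es t u)  = cong₂ es (trans (rename-cong ext-id t) (rename-id t)) (rename-id u)

ext-∘ : ∀ (ρ ρ′ : ℕ → ℕ) i → ext ρ (ext ρ′ i) ≡ ext (ρ ∘ ρ′) i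
ext-∘ ρ ρ′ zero    = refl
ext-∘ ρ ρ′ (suc i) = refl

rename-∘ : ∀ (ρ ρ′ : ℕ → ℕ) t → rename ρ (rename ρ′ t) ≡ rename (ρ ∘ ρ′) t
rename-∘ ρ ρ′ (var i)   = refl
rename-∘ ρ ρ′ (lam t)   =
  cong lam (trans (rename-∘ (ext ρ) (ext ρ′) t) (rename-cong (ext-∘ ρ ρ′) t))
rename-∘ ρ ρ′ (app t u) = cong₂ app (rename-∘ ρ ρ′ t) (rename-∘ ρ ρ′ u)
rename-∘ ρ ρ′ (es t u)  =
  cong₂ es (trans (rename-∘ (ext ρ) (ext ρ′) t) (rename-cong (ext-∘ ρ ρ′) t)) (rename-∘ ρ ρ′ u)

exts-cong : ∀ {σ σ′ : ℕ → Term} → (∀ i → σ i ≡ σ′ i) → ∀ i → exts σ i ≡ exts σ′ i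
exts-cong eq zero    = refl
exts-cong eq (suc i) = cong (rename suc) (eq i)

subst-cong : ∀ {σ σ′ : ℕ → Term} → (∀ i → σ i ≡ σ′ i) → ∀ t → subst σ t ≡ subst σ′ t
subst-cong eq (var i)   = eq i
subst-cong eq (lam t)   = cong lam (subst-cong (exts-cong eq) t)
subst-cong eq (app t u) = cong₂ app (subst-cong eq t) (subst-cong eq u)
subst-cong eq (es t u)  = cong₂ es (subst-cong (exts-cong eq) t) (subst-cong eq u)

exts-var : ∀ (ρ : ℕ → ℕ) i → exts (var ∘ ρ) i ≡ var (ext ρ i)
exts-var ρ zero    = refl
exts-var ρ (suc i) = refl

subst-var : ∀ (ρ : ℕ → ℕ) t → subst (var ∘ ρ) t ≡ rename ρ t
subst-var ρ (var i)   = refl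
subst-var ρ (lam t)   = cong lam (trans (subst-cong (exts-var ρ) t) (subst-var (ext ρ) t))
subst-var ρ (app t u) = cong₂ app (subst-var ρ t) (subst-var ρ u)
subst-var ρ (es t u)  =
  cong₂ es (trans (subst-cong (exts-var ρ) t) (subst-var (ext ρ) t)) (subst-var ρ u)

exts-ext : ∀ (σ : ℕ → Term) (ρ : ℕ → ℕ) i → exts σ (ext ρ i) ≡ exts (σ ∘ ρ) i
exts-ext σ ρ zero    = refl
exts-ext σ ρ (suc i) = refl

subst-rename : ∀ (σ : ℕ → Term) (ρ : ℕ → ℕ) t → subst σ (rename ρ t) ≡ subst (σ ∘ ρ) t
subst-rename σ ρ (var i)   = refl
subst-rename σ ρ (lam t)   =
  cong lam (trans (subst-rename (exts σ) (ext ρ) t) (subst-cong (exts-ext σ ρ) t))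
subst-rename σ ρ (app t u) = cong₂ app (subst-rename σ ρ t) (subst-rename σ ρ u)
subst-rename σ ρ (es t u)  =
  cong₂ es (trans (subst-rename (exts σ) (ext ρ) t) (subst-cong (exts-ext σ ρ) t))
           (subst-rename σ ρ u)

rename-exts : ∀ (ρ : ℕ → ℕ) (σ : ℕ → Term) i →
              rename (ext ρ) (exts σ i) ≡ exts (rename ρ ∘ σ) i
rename-exts ρ σ zero    = refl
rename-exts ρ σ (suc i) = trans (rename-∘ (ext ρ) suc (σ i)) (sym (rename-∘ suc ρ (σ i)))

rename-subst : ∀ (ρ : ℕ → ℕ) (σ : ℕ → Term) t → rename ρ (subst σ t) ≡ subst (rename ρ ∘ σ) t
rename-subst ρ σ (var i)   = refl
rename-subst ρ σ (lam t)   =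
  cong lam (trans (rename-subst (ext ρ) (exts σ) t) (subst-cong (rename-exts ρ σ) t))
rename-subst ρ σ (app t u) = cong₂ app (rename-subst ρ σ t) (rename-subst ρ σ u)
rename-subst ρ σ (es t u)  =
  cong₂ es (trans (rename-subst (ext ρ) (exts σ) t) (subst-cong (rename-exts ρ σ) t))
           (rename-subst ρ σ u)

single-ext : ∀ (ρ : ℕ → ℕ) u i → single (rename ρ u) (ext ρ i) ≡ rename ρ (single u i)
single-ext ρ u zero    = refl
single-ext ρ u (suc i) = refl

extsN-+ : ∀ k (σ : ℕ → Term) i → extsN k σ (k + i) ≡ rename (k +_) (σ i)
extsN-+ zero    σ i = sym (rename-id (σ i))
extsN-+ (suc k) σ i = trans (cong (rename suc) (extsN-+ k σ i)) (rename-∘ suc (k +_) (σ i))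

extsN-exts : ∀ k (σ : ℕ → Term) i → extsN k (exts σ) i ≡ exts (extsN k σ) i
extsN-exts zero    σ i = refl
extsN-exts (suc k) σ i = exts-cong (extsN-exts k σ) i

unfold-rename : ∀ (ρ : ℕ → ℕ) t → unfold (rename ρ t) ≡ rename ρ (unfold t)
unfold-rename ρ (var i)   = refl
unfold-rename ρ (lam t)   = cong lam (unfold-rename (ext ρ) t)
unfold-rename ρ (app t u) = cong₂ app (unfold-rename ρ t) (unfold-rename ρ u)
unfold-rename ρ (es t u)  = begin
  subst (single (unfold (rename ρ u))) (unfold (rename (ext ρ) t))
    ≡⟨ cong₂ (subst ∘ single) (unfold-rename ρ u) (unfold-rename (ext ρ) t) ⟩
  subst (single (rename ρ (unfold u))) (rename (ext ρ) (unfold t))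
    ≡⟨ subst-rename (single (rename ρ (unfold u))) (ext ρ) (unfold t) ⟩
  subst (single (rename ρ (unfold u)) ∘ ext ρ) (unfold t)
    ≡⟨ subst-cong (single-ext ρ (unfold u)) (unfold t) ⟩
  subst (rename ρ ∘ single (unfold u)) (unfold t)
    ≡⟨ rename-subst ρ (single (unfold u)) (unfold t) ⟨
  rename ρ (subst (single (unfold u)) (unfold t)) ∎

plug-∘ : ∀ D C t → plug (D ∘C C) t ≡ plug D (plug C t)
plug-∘ hole        C t = refl
plug-∘ (cλ D)      C t = cong lam (plug-∘ D C t)
plug-∘ (cappL D u) C t = cong (λ s → app s u) (plug-∘ D C t)
plug-∘ (cappR u D) C t = cong (app u) (plug-∘ D C t)
plug-∘ (ces D u)   C t = cong (λ s → es s u) (plug-∘ D C t)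

∘C-identityʳ : ∀ C → C ∘C hole ≡ C
∘C-identityʳ hole        = refl
∘C-identityʳ (cλ C)      = cong cλ (∘C-identityʳ C)
∘C-identityʳ (cappL C u) = cong (λ D → cappL D u) (∘C-identityʳ C)
∘C-identityʳ (cappR u C) = cong (cappR u) (∘C-identityʳ C)
∘C-identityʳ (ces C u)   = cong (λ D → ces D u) (∘C-identityʳ C)

lams-∘ : ∀ D C → lams (D ∘C C) ≡ lams D + lams C
lams-∘ hole        C = refl
lams-∘ (cλ D)      C = cong suc (lams-∘ D C)
lams-∘ (cappL D _) C = lams-∘ D C
lams-∘ (cappR _ D) C = lams-∘ D C
lams-∘ (ces D _)   C = lams-∘ D C

lams-toCtx : ∀ L → lams (toCtx L) ≡ 0
lams-toCtx shole      = refl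
lams-toCtx (sces L _) = lams-toCtx L

relUnfold-toCtx : ∀ L t → relUnfold (toCtx L) t ≡ unfold (plug (toCtx L) t)
relUnfold-toCtx shole      t = refl
relUnfold-toCtx (sces L u) t =
  cong₂ (λ k s → subst (extsN k (single (unfold u))) s) (lams-toCtx L) (relUnfold-toCtx L t)

relUnfold-app : ∀ C t u → relUnfold C (app t u) ≡ app (relUnfold C t) (relUnfold C u)
relUnfold-app hole        t u = refl
relUnfold-app (cλ C)      t u = relUnfold-app C t u
relUnfold-app (cappL C _) t u = relUnfold-app C t u
relUnfold-app (cappR _ C) t u = relUnfold-app C t u
relUnfold-app (ces C _)   t u = cong (subst _) (relUnfold-app C t u)

IsAbs-subst : ∀ σ {t} → IsAbs t → IsAbs (subst σ t)
IsAbs-subst σ (isAbs _) = isAbs _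

IsAbs-relUnfold : ∀ C {t} → IsAbs (unfold t) → IsAbs (relUnfold C t)
IsAbs-relUnfold hole        abs = abs
IsAbs-relUnfold (cλ C)      abs = IsAbs-relUnfold C abs
IsAbs-relUnfold (cappL C _) abs = IsAbs-relUnfold C abs
IsAbs-relUnfold (cappR _ C) abs = IsAbs-relUnfold C abs
IsAbs-relUnfold (ces C _)   abs = IsAbs-subst _ (IsAbs-relUnfold C abs)

IsAbs-app⇒HasβRedex : ∀ {t} u → IsAbs t → HasβRedex (app t u)
IsAbs-app⇒HasβRedex u (isAbs t) = here t u

relUnfold-∘-cong : ∀ D C C′ {t t′} → lams C ≡ lams C′ → relUnfold C t ≡ relUnfold C′ t′ →
                   relUnfold (D ∘C C) t ≡ relUnfold (D ∘C C′) t′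
relUnfold-∘-cong hole        C C′ _    eq = eq
relUnfold-∘-cong (cλ D)      C C′ same-lams eq = relUnfold-∘-cong D C C′ same-lams eq
relUnfold-∘-cong (cappL D _) C C′ same-lams eq = relUnfold-∘-cong D C C′ same-lams eq
relUnfold-∘-cong (cappR _ D) C C′ same-lams eq = relUnfold-∘-cong D C C′ same-lams eq
relUnfold-∘-cong (ces D u)   C C′ same-lams eq =
  cong₂ (λ k s → subst (extsN k (single (unfold u))) s)
        (trans (lams-∘ D C) (trans (cong (lams D +_) same-lams) (sym (lams-∘ D C′))))
        (relUnfold-∘-cong D C C′ same-lams eq)

relUnfold-rename-outside : ∀ C (ρ : ℕ → ℕ) t →
  relUnfold C (rename (λ i → depth C + ρ i) t) ≡ rename (λ i → lams C + ρ i) (unfold t)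
relUnfold-rename-outside hole        ρ t = unfold-rename ρ t
relUnfold-rename-outside (cλ C)      ρ t = begin
  relUnfold C (rename (λ i → suc (depth C + ρ i)) t)
    ≡⟨ cong (relUnfold C) (rename-cong (λ i → sym (+-suc (depth C) (ρ i))) t) ⟩
  relUnfold C (rename (λ i → depth C + suc (ρ i)) t)
    ≡⟨ relUnfold-rename-outside C (suc ∘ ρ) t ⟩
  rename (λ i → lams C + suc (ρ i)) (unfold t)
    ≡⟨ rename-cong (λ i → +-suc (lams C) (ρ i)) (unfold t) ⟩
  rename (λ i → suc (lams C + ρ i)) (unfold t) ∎
relUnfold-rename-outside (cappL C _) ρ t = relUnfold-rename-outside C ρ t
relUnfold-rename-outside (cappR _ C) ρ t = relUnfold-rename-outside C ρ t
relUnfold-rename-outside (ces C u)   ρ t = begin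
  subst σ (relUnfold C (rename (λ i → suc (depth C + ρ i)) t))
    ≡⟨ cong (subst σ ∘ relUnfold C) (rename-cong (λ i → sym (+-suc (depth C) (ρ i))) t) ⟩
  subst σ (relUnfold C (rename (λ i → depth C + suc (ρ i)) t))
    ≡⟨ cong (subst σ) (relUnfold-rename-outside C (suc ∘ ρ) t) ⟩
  subst σ (rename (λ i → lams C + suc (ρ i)) (unfold t))
    ≡⟨ subst-rename σ (λ i → lams C + suc (ρ i)) (unfold t) ⟩
  subst (λ i → σ (lams C + suc (ρ i))) (unfold t)
    ≡⟨ subst-cong (λ i → extsN-+ (lams C) (single (unfold u)) (suc (ρ i))) (unfold t) ⟩
  subst (λ i → var (lams C + ρ i)) (unfold t)
    ≡⟨ subst-var (λ i → lams C + ρ i) (unfold t) ⟩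
  rename (λ i → lams C + ρ i) (unfold t) ∎
  where σ = extsN (lams C) (single (unfold u))

relUnfold-es-var≡definiens : ∀ C u →
  relUnfold (ces C u) (var (depth C)) ≡ relUnfold (ces C u) (shift (suc (depth C)) u)
relUnfold-es-var≡definiens C u = begin
  subst σ (relUnfold C (var (depth C)))
    ≡⟨ cong (subst σ ∘ relUnfold C ∘ var) (sym (+-identityʳ (depth C))) ⟩
  subst σ (relUnfold C (rename (depth C +_) (var 0)))
    ≡⟨ cong (subst σ) (relUnfold-rename-outside C (λ i → i) (var 0)) ⟩
  σ (lams C + 0)
    ≡⟨ extsN-+ (lams C) (single (unfold u)) 0 ⟩
  rename (lams C +_) (unfold u)
    ≡⟨ relUnfold-rename-outside (ces C u) (λ i → i) u ⟨
  relUnfold (ces C u) (shift (suc (depth C)) u) ∎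
  where σ = extsN (lams C) (single (unfold u))

-- Subterm s k t : s occurs in t beneath k λ-binders; unfoldings contain no ES.
data Subterm (s : Term) : ℕ → Term → Set where
  here    : Subterm s 0 s
  under-λ : ∀ {k t} → Subterm s k t → Subterm s (suc k) (lam t)
  app-l   : ∀ {k t u} → Subterm s k t → Subterm s k (app t u)
  app-r   : ∀ {k t u} → Subterm s k u → Subterm s k (app t u)

Subterm-subst : ∀ {s k t} σ → Subterm s k t → Subterm (subst (extsN k σ) s) k (subst σ t)
Subterm-subst σ here                      = here
Subterm-subst {s} {suc k} σ (under-λ occ) =
  under-λ (transport (λ s′ → Subterm s′ k _) (subst-cong (extsN-exts k σ) s)
                     (Subterm-subst (exts σ) occ))
Subterm-subst σ (app-l occ)               = app-l (Subterm-subst σ occ)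
Subterm-subst σ (app-r occ)               = app-r (Subterm-subst σ occ)

Subterm-HasβRedex : ∀ {s k t} → Subterm s k t → HasβRedex s → HasβRedex t
Subterm-HasβRedex here          β = β
Subterm-HasβRedex (under-λ occ) β = inλ (Subterm-HasβRedex occ β)
Subterm-HasβRedex (app-l occ)   β = appl (Subterm-HasβRedex occ β)
Subterm-HasβRedex (app-r occ)   β = appr (Subterm-HasβRedex occ β)

relUnfold-Subterm-unfold : ∀ C t → Subterm (relUnfold C t) (lams C) (unfold (plug C t))
relUnfold-Subterm-unfold hole        t = here
relUnfold-Subterm-unfold (cλ C)      t = under-λ (relUnfold-Subterm-unfold C t)
relUnfold-Subterm-unfold (cappL C _) t = app-l (relUnfold-Subterm-unfold C t)
relUnfold-Subterm-unfold (cappR _ C) t = app-r (relUnfold-Subterm-unfold C t)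
relUnfold-Subterm-unfold (ces C u)   t =
  Subterm-subst (single (unfold u)) (relUnfold-Subterm-unfold C t)

relUnfold-HasβRedex : ∀ C t → HasβRedex (relUnfold C t) → HasβRedex (unfold (plug C t))
relUnfold-HasβRedex C t = Subterm-HasβRedex (relUnfold-Subterm-unfold C t)

IsAbs-in-function-position : ∀ C L u t → IsAbs (relUnfold (C ∘C cappL (toCtx L) u) t) →
                             HasβRedex (unfold (plug C (app (plug (toCtx L) t) u)))
IsAbs-in-function-position C L u t abs =
  relUnfold-HasβRedex C (app (plug (toCtx L) t) u)
    (transport HasβRedex (sym (relUnfold-app C (plug (toCtx L) t) u))
               (IsAbs-app⇒HasβRedex (relUnfold C u) (transport IsAbs function≡ abs)))
  where
  function≡ : relUnfold (C ∘C cappL (toCtx L) u) t ≡ relUnfold C (plug (toCtx L) t)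
  function≡ = begin
    relUnfold (C ∘C cappL (toCtx L) u) t
      ≡⟨ relUnfold-∘-cong C (cappL (toCtx L) u) hole (lams-toCtx L) (relUnfold-toCtx L t) ⟩
    relUnfold (C ∘C hole) (plug (toCtx L) t)
      ≡⟨ cong (λ E → relUnfold E (plug (toCtx L) t)) (∘C-identityʳ C) ⟩
    relUnfold C (plug (toCtx L) t) ∎

Applicative-IsAbs⇒HasβRedex : ∀ {E} t → Applicative E → IsAbs (relUnfold E t) →
                              HasβRedex (unfold (plug E t))
Applicative-IsAbs⇒HasβRedex t (C , L , u , refl) abs =
  transport (HasβRedex ∘ unfold) (sym (plug-∘ C (cappL (toCtx L) u) t))
            (IsAbs-in-function-position C L u t abs)

DBRedex⇒HasβRedex : ∀ {t} → DBRedex t → HasβRedex (unfold t)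
DBRedex⇒HasβRedex (C , L , s , u , refl) =
  IsAbs-in-function-position C L u (lam s)
    (IsAbs-relUnfold (C ∘C cappL (toCtx L) u) (isAbs (unfold s)))

UsefulLSRedex⇒HasβRedex : ∀ {t} → UsefulLSRedex t → HasβRedex (unfold t)
UsefulLSRedex⇒HasβRedex (D , C , u , refl , useful) =
  transport (HasβRedex ∘ unfold) (plug-∘ D (ces C u) x) (unfolding-of-x useful)
  where
  x = var (depth C)
  E = D ∘C ces C u
  r = relUnfold E (shift (suc (depth C)) u)

  x≡u : relUnfold E x ≡ r
  x≡u = relUnfold-∘-cong D (ces C u) (ces C u) refl (relUnfold-es-var≡definiens C u)

  unfolding-of-x : HasβRedex r ⊎ (IsAbs r × Applicative E) → HasβRedex (unfold (plug E x))
  unfolding-of-x (inj₁ β) =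
    relUnfold-HasβRedex E x (transport HasβRedex (sym x≡u) β)
  unfolding-of-x (inj₂ (abs , applicative)) =
    Applicative-IsAbs⇒HasβRedex x applicative (transport IsAbs (sym x≡u) abs)

UsefulRedex⇒HasβRedex : ∀ {t} → UsefulRedex t → HasβRedex (unfold t)
UsefulRedex⇒HasβRedex (inj₁ dB) = DBRedex⇒HasβRedex dB
UsefulRedex⇒HasβRedex (inj₂ ls) = UsefulLSRedex⇒HasβRedex ls

mainTheorem8 : (t : Term) → βNormal (unfold t) → UsefulNormal t
mainTheorem8 _ normal = normal ∘ UsefulRedex⇒HasβRedex
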